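{- Let $x$ be a positive integer and let $y,k$ be nonnegative integers. Then: (a) $F(x,y)=F(x+ky,y)$; (b) $F(x,kx+y)=F(x,y)+k$; (c) $F(ax,ay)=F(x,y)$ for every positive integer $a$; (d) $F(x,x-1)=x$; (e) $F(x,y)\le y+1$; (f) $F(x,y)\le\frac{x+1}{2}$ if $1\le y\le x-2$.
   Context: The function $F:\mathbb Z_{>0}\times\mathbb Z_{\ge0}\to\mathbb Z_{>0}$ is defined as follows. Given $x_1>0$ and $x_2\ge 0$, for each $i\ge2$ with $x_i>0$ let $x_{i+1}$ be the least nonnegative residue of $-x_{i-1}$ modulo $x_i$ (the unique integer with $0\le x_{i+1}<x_i$ and $x_i\mid x_{i-1}+x_{i+1}$); $F(x_1,x_2)$ is the number of positive terms in the sequence $(x_i)$. In particular $F(x,0)=1$. -}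

module Defs where

open import Data.Nat using (ℕ; zero; suc; _+_; _∸_; NonZero)
open import Data.Nat.DivMod using (_%_)

-- least nonnegative residue of (- a) modulo b, for b > 0
negMod : (a b : ℕ) → .{{NonZero b}} → ℕ
negMod a b = (b ∸ (a % b)) % b

-- fuel-driven iteration: counts positive terms of the sequence
-- starting with consecutive terms (a , b), a assumed positive.
-- Each step strictly decreases the second component, so fuel b+1 suffices.
count : ℕ → ℕ → ℕ → ℕ
count zero    a b       = 0
count (suc n) a zero    = 1
count (suc n) a (suc b) = suc (count n (suc b) (negMod a (suc b)))

F : ℕ → ℕ → ℕ
F x y = count (suc y) x y

-- Each step (a , b) ↦ (b , −a mod b) depends on a only modulo b and commutes with scaling,
-- which gives (a) and (c). When a ≤ b the step is (a , b) ↦ (b , b − a), so adding a to b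
-- costs exactly one extra term; this gives (b), and (d) by descent on x. Bound (e) holds
-- because the terms strictly decrease. For (f) write x = d + y with d ≥ 2 and y = k d + r
-- with r < d: by (a) and (b), F x y = F d r + k ≤ r + 1 + k, which is at most (x + 1)/2.
module Submission where

open import Defs
open import Data.Nat using (ℕ; zero; suc; _+_; _*_; _∸_; _≤_; _<_; z≤n; s≤s; NonZero)
open import Data.Nat.Properties
open import Data.Nat.DivMod
open import Data.Nat.Solver using (module +-*-Solver)
open import Data.Product using (_×_; _,_)
open import Data.Sum using (inj₁; inj₂)
open import Relation.Binary.PropositionalEquality
  using (_≡_; refl; sym; trans; cong; cong₂; subst; module ≡-Reasoning)

negMod-< : ∀ a b .{{_ : NonZero b}} → negMod a b < b
negMod-< a b = m%n<n (b ∸ a % b) b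

negMod-+-* : ∀ a k b .{{_ : NonZero b}} → negMod (a + k * b) b ≡ negMod a b
negMod-+-* a k b = cong (λ t → (b ∸ t) % b) ([m+kn]%n≡m%n a k b)

negMod-+ : ∀ a b .{{_ : NonZero b}} → negMod (a + b) b ≡ negMod a b
negMod-+ a b = cong (λ t → (b ∸ t) % b) ([m+n]%n≡m%n a b)

negMod-≤ : ∀ a b .{{_ : NonZero b}} → 1 ≤ a → a ≤ b → negMod a b ≡ b ∸ a
negMod-≤ a b 1≤a a≤b with m≤n⇒m<n∨m≡n a≤b
... | inj₁ a<b = begin
  (b ∸ a % b) % b ≡⟨ cong (λ t → (b ∸ t) % b) (m<n⇒m%n≡m a<b) ⟩
  (b ∸ a) % b     ≡⟨ m<n⇒m%n≡m (∸-monoʳ-< 1≤a a≤b) ⟩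
  b ∸ a           ∎
  where open ≡-Reasoning
... | inj₂ refl = begin
  (a ∸ a % a) % a ≡⟨ cong (λ t → (a ∸ t) % a) (n%n≡0 a) ⟩
  a % a           ≡⟨ n%n≡0 a ⟩
  0               ≡⟨ n∸n≡0 a ⟨
  a ∸ a           ∎
  where open ≡-Reasoning

negMod-*ʳ : ∀ a b c .{{_ : NonZero b}} .{{_ : NonZero (b * c)}} →
  negMod (a * c) (b * c) ≡ negMod a b * c
negMod-*ʳ a b c = begin
  (b * c ∸ a * c % (b * c)) % (b * c) ≡⟨ cong (λ t → (b * c ∸ t) % (b * c)) (m%n*o≡m*o%[n*o] a b c) ⟨
  (b * c ∸ a % b * c) % (b * c)       ≡⟨ cong (_% (b * c)) (*-distribʳ-∸ c b (a % b)) ⟨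
  (b ∸ a % b) * c % (b * c)           ≡⟨ m%n*o≡m*o%[n*o] (b ∸ a % b) b c ⟨
  (b ∸ a % b) % b * c                 ∎
  where open ≡-Reasoning

count-fuel-irrelevant : ∀ m n a b → b < m → b < n → count m a b ≡ count n a b
count-fuel-irrelevant (suc m) (suc n) a zero    _       _       = refl
count-fuel-irrelevant (suc m) (suc n) a (suc b) (s≤s p) (s≤s q) =
  cong suc (count-fuel-irrelevant m n (suc b) (negMod a (suc b))
    (≤-trans (negMod-< a (suc b)) p) (≤-trans (negMod-< a (suc b)) q))

F-suc : ∀ a b → F a (suc b) ≡ suc (F (suc b) (negMod a (suc b)))
F-suc a b = cong suc (count-fuel-irrelevant (suc b) (suc (negMod a (suc b))) (suc b) (negMod a (suc b))
  (negMod-< a (suc b)) ≤-refl)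

F-+-* : ∀ x k y → F (x + k * y) y ≡ F x y
F-+-* x k zero    = refl
F-+-* x k (suc b) = begin
  F (x + k * suc b) (suc b)                        ≡⟨ F-suc (x + k * suc b) b ⟩
  suc (F (suc b) (negMod (x + k * suc b) (suc b))) ≡⟨ cong (λ t → suc (F (suc b) t)) (negMod-+-* x k (suc b)) ⟩
  suc (F (suc b) (negMod x (suc b)))               ≡⟨ F-suc x b ⟨
  F x (suc b)                                      ∎
  where open ≡-Reasoning

F-+ : ∀ x y → F (x + y) y ≡ F x y
F-+ x y = trans (cong (λ t → F (x + t) y) (sym (*-identityˡ y))) (F-+-* x 1 y)

F-*-+ : ∀ x → 1 ≤ x → ∀ k y → F x (k * x + y) ≡ F x y + k
F-*-+ x       _           zero    y = sym (+-identityʳ (F x y))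
F-*-+ (suc m) 1≤x@(s≤s _) (suc k) y = begin
  F x ((x + k * x) + y)              ≡⟨ cong (F x) (+-assoc x (k * x) y) ⟩
  F x (x + z)                        ≡⟨ F-suc x (m + z) ⟩
  suc (F (x + z) (negMod x (x + z))) ≡⟨ cong (λ t → suc (F (x + z) t)) negMod-x[x+z] ⟩
  suc (F (x + z) z)                  ≡⟨ cong suc (F-+ x z) ⟩
  suc (F x z)                        ≡⟨ cong suc (F-*-+ x 1≤x k y) ⟩
  suc (F x y + k)                    ≡⟨ +-suc (F x y) k ⟨
  F x y + suc k                      ∎
  where
  open ≡-Reasoning
  x = suc m
  z = k * x + y
  negMod-x[x+z] : negMod x (x + z) ≡ z
  negMod-x[x+z] = trans (negMod-≤ x (x + z) 1≤x (m≤m+n x z)) (m+n∸m≡n x z)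

F-*ʳ : ∀ c → 1 ≤ c → ∀ x y → F (x * c) (y * c) ≡ F x y
F-*ʳ (suc a) _ x y = go (suc y) x y ≤-refl
  where
  c = suc a
  go : ∀ n x y → y < n → F (x * c) (y * c) ≡ F x y
  go (suc n) x zero    _       = refl
  go (suc n) x (suc b) (s≤s p) = begin
    F (x * c) (suc b * c)                            ≡⟨ F-suc (x * c) (a + b * c) ⟩
    suc (F (suc b * c) (negMod (x * c) (suc b * c))) ≡⟨ cong (λ t → suc (F (suc b * c) t)) (negMod-*ʳ x (suc b) c) ⟩
    suc (F (suc b * c) (negMod x (suc b) * c))       ≡⟨ cong suc (go n (suc b) (negMod x (suc b)) negMod<n) ⟩
    suc (F (suc b) (negMod x (suc b)))               ≡⟨ F-suc x b ⟨
    F x (suc b)                                      ∎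
    where
    open ≡-Reasoning
    negMod<n : negMod x (suc b) < n
    negMod<n = ≤-trans (negMod-< x (suc b)) p

F-*ˡ : ∀ c → 1 ≤ c → ∀ x y → F (c * x) (c * y) ≡ F x y
F-*ˡ c 1≤c x y = trans (cong₂ F (*-comm c x) (*-comm c y)) (F-*ʳ c 1≤c x y)

F[1+n,n]≡1+n : ∀ n → F (suc n) n ≡ suc n
F[1+n,n]≡1+n zero    = refl
F[1+n,n]≡1+n (suc b) = begin
  F (2 + b) (suc b)                            ≡⟨ F-suc (2 + b) b ⟩
  suc (F (suc b) (negMod (1 + suc b) (suc b))) ≡⟨ cong (λ t → suc (F (suc b) t)) (negMod-+ 1 (suc b)) ⟩
  suc (F (suc b) (negMod 1 (suc b)))           ≡⟨ cong (λ t → suc (F (suc b) t)) (negMod-≤ 1 (suc b) ≤-refl (s≤s z≤n)) ⟩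
  suc (F (suc b) b)                            ≡⟨ cong suc (F[1+n,n]≡1+n b) ⟩
  2 + b                                        ∎
  where open ≡-Reasoning

count-≤ : ∀ n a b → count n a b ≤ suc b
count-≤ zero    a b       = z≤n
count-≤ (suc n) a zero    = ≤-refl
count-≤ (suc n) a (suc b) = s≤s (≤-trans (count-≤ n (suc b) (negMod a (suc b))) (negMod-< a (suc b)))

F-≤ : ∀ x y → F x y ≤ y + 1
F-≤ x y = ≤-trans (count-≤ (suc y) x y) (≤-reflexive (+-comm 1 y))

2*F[d+y,y]≤d+y+1 : ∀ d y → 2 ≤ d → 2 * F (d + y) y ≤ d + y + 1
2*F[d+y,y]≤d+y+1 d y 2≤d@(s≤s (s≤s _)) = begin
  2 * F (d + y) y         ≡⟨ cong (2 *_) (F-+ d y) ⟩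
  2 * F d y               ≡⟨ cong (λ t → 2 * F d t) y≡k*d+r ⟩
  2 * F d (k * d + r)     ≡⟨ cong (2 *_) (F-*-+ d (s≤s z≤n) k r) ⟩
  2 * (F d r + k)         ≤⟨ *-monoʳ-≤ 2 (+-monoˡ-≤ k (F-≤ d r)) ⟩
  2 * (r + 1 + k)         ≡⟨ rearrange r k ⟩
  suc r + (k * 2 + r) + 1 ≤⟨ +-monoˡ-≤ 1 (+-mono-≤ (m%n<n y d) (+-monoˡ-≤ r (*-monoʳ-≤ k 2≤d))) ⟩
  d + (k * d + r) + 1     ≡⟨ cong (λ t → d + t + 1) y≡k*d+r ⟨
  d + y + 1               ∎
  where
  open ≤-Reasoning
  k = y / d
  r = y % d
  y≡k*d+r : y ≡ k * d + r
  y≡k*d+r = trans (m≡m%n+[m/n]*n y d) (+-comm r (k * d))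
  rearrange : ∀ r k → 2 * (r + 1 + k) ≡ suc r + (k * 2 + r) + 1
  rearrange = solve 2 (λ r k → con 2 :* (r :+ con 1 :+ k) := (con 1 :+ r) :+ (k :* con 2 :+ r) :+ con 1) refl
    where open +-*-Solver

2*F≤x+1 : ∀ x y → 2 + y ≤ x → 2 * F x y ≤ x + 1
2*F≤x+1 x y 2+y≤x = subst (λ t → 2 * F t y ≤ t + 1) (m∸n+n≡m (m+n≤o⇒n≤o 2 2+y≤x))
  (2*F[d+y,y]≤d+y+1 (x ∸ y) y (m+n≤o⇒m≤o∸n 2 2+y≤x))

lemma3p2 : (x : ℕ) → 1 ≤ x → (y k : ℕ) →
    (F x y ≡ F (x + k * y) y)
    × (F x (k * x + y) ≡ F x y + k)
    × ((a : ℕ) → 1 ≤ a → F (a * x) (a * y) ≡ F x y)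
    × (F x (x ∸ 1) ≡ x)
    × (F x y ≤ y + 1)
    × (1 ≤ y → y ≤ x ∸ 2 → 2 * F x y ≤ x + 1)
lemma3p2 x@(suc m) 1≤x y k =
    sym (F-+-* x k y)
  , F-*-+ x 1≤x k y
  , (λ a 1≤a → F-*ˡ a 1≤a x y)
  , F[1+n,n]≡1+n m
  , F-≤ x y
  , λ 1≤y y≤x∸2 → 2*F≤x+1 x y (2+y≤x x y 1≤y y≤x∸2)
  where
  -- with truncated subtraction, y ≤ x ∸ 2 alone does not force x ≥ 2; 1 ≤ y does
  2+y≤x : ∀ x y → 1 ≤ y → y ≤ x ∸ 2 → 2 + y ≤ x
  2+y≤x zero          _ (s≤s _) ()
  2+y≤x (suc zero)    _ (s≤s _) ()
  2+y≤x (suc (suc x)) _ _       y≤x∸2 = s≤s (s≤s y≤x∸2)
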